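{- Let $G$ and $H$ be connected graphs, each having at least two vertices. Then $\chi_{lid}(G \square H) \leq \chi(G)\,\chi(H)$.
   Context: $\chi(G)$ is the chromatic number of $G$. A proper $k$-coloring of a graph $G$ is a map $f:V(G)\to\{1,\dots,k\}$ with $f(u)\neq f(v)$ for every edge $uv$. For a vertex $v$, $N[v]$ denotes its closed neighborhood, and $f(S)=\{f(x):x\in S\}$. A lid-coloring of $G$ is a proper coloring $f$ such that for every edge $uv$ with $N[u]\neq N[v]$ we have $f(N[u])\neq f(N[v])$; $\chi_{lid}(G)$ is the smallest number of colors in a lid-coloring of $G$. The Cartesian product $G\square H$ has vertex set $V(G)\times V(H)$, where $(u_1,v_1)$ and $(u_2,v_2)$ are adjacent iff either $u_1=u_2$ and $v_1v_2\in E(H)$, or $v_1=v_2$ and $u_1u_2\in E(G)$. -}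

module Defs where

open import Level using (Level; _⊔_; suc; 0ℓ)
open import Data.Nat using (ℕ; _≤_)
open import Data.Fin using (Fin)
open import Data.Product using (Σ; _×_; _,_; ∃)
open import Data.Sum using (_⊎_)
open import Relation.Nullary using (¬_; Dec)
open import Relation.Binary.PropositionalEquality using (_≡_; _≢_)
open import Function.Bundles using (_↔_; _⇔_)

record Graph : Set₁ where
  field
    V     : Set
    Adj   : V → V → Set
    adj-sym : ∀ {x y} → Adj x y → Adj y x
    adj-irrefl : ∀ {x} → ¬ Adj x x
open Graph public

Finite : Graph → Set
Finite G = Σ ℕ λ n → V G ↔ Fin n

DecAdj : Graph → Set
DecAdj G = ∀ x y → Dec (Adj G x y)

data Walk (G : Graph) : V G → V G → Set where
  here : ∀ {x} → Walk G x x
  step : ∀ {x y z} → Adj G x y → Walk G y z → Walk G x z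

Connected : Graph → Set
Connected G = ∀ x y → Walk G x y

AtLeastTwo : Graph → Set
AtLeastTwo G = Σ (V G) λ x → Σ (V G) λ y → x ≢ y

-- proper colorings with colors {1..k} represented by Fin k
Proper : (G : Graph) (k : ℕ) → (V G → Fin k) → Set
Proper G k f = ∀ {u v} → Adj G u v → f u ≢ f v

Colorable : Graph → ℕ → Set
Colorable G k = Σ (V G → Fin k) (Proper G k)

IsChromaticNumber : Graph → ℕ → Set
IsChromaticNumber G k = Colorable G k × (∀ j → Colorable G j → k ≤ j)

N[_]∋_ : {G : Graph} → V G → V G → Set
N[_]∋_ {G} v x = (x ≡ v) ⊎ Adj G v x

ColorsN : (G : Graph) {k : ℕ} → (V G → Fin k) → V G → Fin k → Set
ColorsN G f v c = Σ (V G) λ x → N[_]∋_ {G} v x × f x ≡ c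

SameN : (G : Graph) → V G → V G → Set
SameN G u v = ∀ x → (N[_]∋_ {G} u x ⇔ N[_]∋_ {G} v x)

SameColors : (G : Graph) {k : ℕ} → (V G → Fin k) → V G → V G → Set
SameColors G {k} f u v = ∀ (c : Fin k) → (ColorsN G f u c ⇔ ColorsN G f v c)

IsLid : (G : Graph) (k : ℕ) → (V G → Fin k) → Set
IsLid G k f = Proper G k f ×
  (∀ {u v} → Adj G u v → ¬ SameN G u v → ¬ SameColors G f u v)

LidColorable : Graph → ℕ → Set
LidColorable G k = Σ (V G → Fin k) (IsLid G k)

IsLidChromaticNumber : Graph → ℕ → Set
IsLidChromaticNumber G k = LidColorable G k × (∀ j → LidColorable G j → k ≤ j)

□Adj : (G H : Graph) → V G × V H → V G × V H → Set
□Adj G H (u₁ , v₁) (u₂ , v₂) = (u₁ ≡ u₂ × Adj H v₁ v₂) ⊎ (v₁ ≡ v₂ × Adj G u₁ u₂)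

_□_ : Graph → Graph → Graph
G □ H = record
  { V = V G × V H
  ; Adj = □Adj G H
  ; adj-sym = symP
  ; adj-irrefl = irr
  }
  where
  open import Data.Sum using (inj₁; inj₂)
  open import Relation.Binary.PropositionalEquality using (sym)
  symP : ∀ {x y} → □Adj G H x y → □Adj G H y x
  symP (inj₁ (e , a)) = inj₁ (sym e , Graph.adj-sym H a)
  symP (inj₂ (e , a)) = inj₂ (sym e , Graph.adj-sym G a)
  irr : ∀ {x} → ¬ □Adj G H x x
  irr (inj₁ (_ , a)) = Graph.adj-irrefl H a
  irr (inj₂ (_ , a)) = Graph.adj-irrefl G a

-- Color G □ H by pairs: (x , y) gets (g x , h y), encoded in Fin (a * b). Across an H-edge
-- (u , v)(u , v'), pick a G-neighbor w of u (connectedness and two vertices exclude isolated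
-- vertices): the color (g w , h v) lies in f(N[(u , v)]), but every vertex of N[(u , v')] is
-- (u , v'), some (u , y) or some (x , v'), and properness of g and h rules out each of them.
-- G-edges are symmetric. Since the vertex set is finite and adjacency decidable, being
-- lid-colorable with k colors is decidable, so a least such k exists, and it is at most a * b.
module Submission where

open import Defs
open import Data.Nat using (ℕ; zero; suc; _≤_; _*_; _≤?_)
open import Data.Nat.Properties using (≰⇒>)
open import Data.Fin using (Fin; toℕ; fromℕ; fromℕ<; inject; combine)
open import Data.Fin.Properties
  using (any?; all?; ¬∀⟶∃¬-smallest; toℕ-fromℕ; toℕ-fromℕ<; toℕ-inject; toℕ≤pred[n];
         combine-injective; *↔×)
  renaming (_≟_ to _≟ᶠ_)
open import Data.Vec using (Vec; []; _∷_; lookup; tabulate)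
open import Data.Vec.Properties using (lookup∘tabulate)
open import Data.Product using (Σ; _×_; _,_; proj₁; proj₂; ∃)
open import Data.Product.Function.NonDependent.Propositional using (_×-↔_)
open import Data.Sum using (inj₁; inj₂)
open import Function using (_∘_)
open import Function.Bundles using (_↔_; _⇔_; mk⇔; Inverse; Equivalence)
open import Function.Properties.Inverse using (↔-sym; ↔-trans; ↔⇒↣)
open import Relation.Nullary using (¬_; Dec; yes; no; contradiction)
open import Relation.Nullary.Decidable
  using (map′; _×-dec_; _⊎-dec_; _→-dec_; ¬?; decidable-stable; via-injection)
open import Relation.Unary using (Pred; Decidable)
open import Relation.Binary using (DecidableEquality)
open import Relation.Binary.PropositionalEquality using (_≡_; refl; sym; trans; cong; subst)

least-below : ∀ {p} {P : Pred ℕ p} → Decidable P → ∀ K → P K →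
  Σ ℕ λ c → (P c × (∀ j → P j → c ≤ j)) × c ≤ K
-- The least i ≤ K at which ¬ P fails is the least witness of P.
least-below {P = P} P? K pK
  with i , ¬¬Pi , below ← ¬∀⟶∃¬-smallest (suc K) (¬_ ∘ P ∘ toℕ) (¬? ∘ P? ∘ toℕ)
                           (λ none → none (fromℕ K) (subst P (sym (toℕ-fromℕ K)) pK))
  = toℕ i , (decidable-stable (P? (toℕ i)) ¬¬Pi , minimal) , toℕ≤pred[n] i
  where
  minimal : ∀ j → P j → toℕ i ≤ j
  minimal j pj with toℕ i ≤? j
  ... | yes i≤j = i≤j
  ... | no i≰j = contradiction (subst P (sym (trans (toℕ-inject j′) (toℕ-fromℕ< _))) pj) (below j′)
    where
    j′ : Fin (toℕ i)
    j′ = fromℕ< (≰⇒> i≰j)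

_⇔?_ : ∀ {A B : Set} → Dec A → Dec B → Dec (A ⇔ B)
A? ⇔? B? = map′ (λ (to , from) → mk⇔ to from) (λ A⇔B → Equivalence.to A⇔B , Equivalence.from A⇔B)
  ((A? →-dec B?) ×-dec (B? →-dec A?))

∃-Vec? : ∀ {k p} n {P : Pred (Vec (Fin k) n) p} → Decidable P → Dec (∃ P)
∃-Vec? zero    P? = map′ ([] ,_) (λ { ([] , p) → p }) (P? [])
∃-Vec? (suc n) P? = map′ (λ (c , v , p) → c ∷ v , p) (λ { (c ∷ v , p) → c , v , p })
  (any? λ c → ∃-Vec? n (P? ∘ (c ∷_)))

module Enumeration {A : Set} {n : ℕ} (A↔Fin : A ↔ Fin n) where
  open Inverse A↔Fin using (to; from; strictlyInverseʳ)

  ∃? : ∀ {p} {P : Pred A p} → Decidable P → Dec (∃ P)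
  ∃? {P = P} P? = map′ (λ (i , p) → from i , p)
    (λ (x , p) → to x , subst P (sym (strictlyInverseʳ x)) p) (any? (P? ∘ from))

  ∀? : ∀ {p} {P : Pred A p} → Decidable P → Dec (∀ x → P x)
  ∀? {P = P} P? = map′ (λ all x → subst P (strictlyInverseʳ x) (all (to x))) (λ all → all ∘ from)
    (all? (P? ∘ from))

  _≟_ : DecidableEquality A
  _≟_ = via-injection (↔⇒↣ A↔Fin) _≟ᶠ_

ColorsN-resp-≗ : ∀ (G : Graph) {k} {f f′ : V G → Fin k} → (∀ x → f x ≡ f′ x) →
  ∀ {u c} → ColorsN G f u c → ColorsN G f′ u c
ColorsN-resp-≗ G f≗f′ (x , x∈N , fx≡c) = x , x∈N , trans (sym (f≗f′ x)) fx≡c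

IsLid-resp-≗ : ∀ (G : Graph) {k} {f f′ : V G → Fin k} → (∀ x → f x ≡ f′ x) →
  IsLid G k f → IsLid G k f′
IsLid-resp-≗ G {k} {f} {f′} f≗f′ (proper , separating) =
  proper′ , λ uv ¬sameN → separating uv ¬sameN ∘ back
  where
  f′≗f : ∀ x → f′ x ≡ f x
  f′≗f = sym ∘ f≗f′
  proper′ : Proper G k f′
  proper′ {u} {v} uv f′u≡f′v = proper uv (trans (f≗f′ u) (trans f′u≡f′v (f′≗f v)))
  back : ∀ {u v} → SameColors G f′ u v → SameColors G f u v
  back same c = mk⇔
    (ColorsN-resp-≗ G f′≗f ∘ Equivalence.to (same c) ∘ ColorsN-resp-≗ G f≗f′)
    (ColorsN-resp-≗ G f′≗f ∘ Equivalence.from (same c) ∘ ColorsN-resp-≗ G f≗f′)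

module _ (G : Graph) (finite : Finite G) (adj? : DecAdj G) where
  private
    n : ℕ
    n = proj₁ finite
    open Enumeration (proj₂ finite)
    open Inverse (proj₂ finite) using (to; from; strictlyInverseʳ)

    implicit² : {P : V G → V G → Set} → Dec (∀ u v → P u v) → Dec (∀ {u v} → P u v)
    implicit² = map′ (λ all {u} {v} → all u v) (λ all u v → all)

    N∋? : ∀ u x → Dec (N[_]∋_ {G} u x)
    N∋? u x = (x ≟ u) ⊎-dec adj? u x

    ColorsN? : ∀ {k} (f : V G → Fin k) u c → Dec (ColorsN G f u c)
    ColorsN? f u c = ∃? λ x → N∋? u x ×-dec (f x ≟ᶠ c)

  IsLid? : ∀ k (f : V G → Fin k) → Dec (IsLid G k f)
  IsLid? k f =
    implicit² (∀? λ u → ∀? λ v → adj? u v →-dec ¬? (f u ≟ᶠ f v)) ×-dec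
    implicit² (∀? λ u → ∀? λ v → adj? u v →-dec
      ¬? (∀? λ x → N∋? u x ⇔? N∋? v x) →-dec
      ¬? (all? λ c → ColorsN? f u c ⇔? ColorsN? f v c))

  LidColorable? : ∀ k → Dec (LidColorable G k)
  LidColorable? k = map′ (λ (c , lid) → lookup c ∘ to , lid)
    (λ (f , lid) → tabulate (f ∘ from) , IsLid-resp-≗ G (sym ∘ tabulated f) lid)
    (∃-Vec? n λ c → IsLid? k (lookup c ∘ to))
    where
    tabulated : (f : V G → Fin k) → ∀ x → lookup (tabulate (f ∘ from)) (to x) ≡ f x
    tabulated f x = trans (lookup∘tabulate (f ∘ from) (to x)) (cong f (strictlyInverseʳ x))

NoIsolatedVertex : Graph → Set
NoIsolatedVertex G = ∀ u → ∃ (Adj G u)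

connected⇒noIsolatedVertex : ∀ {G} → Connected G → AtLeastTwo G → NoIsolatedVertex G
connected⇒noIsolatedVertex connected (x , y , x≢y) u with connected u x | connected u y
... | step ux _ | _         = _ , ux
... | here      | step uy _ = _ , uy
... | here      | here      = contradiction refl x≢y

Finite-□ : ∀ G H → Finite G → Finite H → Finite (G □ H)
Finite-□ _ _ (n , G↔Fin) (m , H↔Fin) = n * m , ↔-trans (G↔Fin ×-↔ H↔Fin) (↔-sym *↔×)

DecAdj-□ : ∀ G H → DecidableEquality (V G) → DecidableEquality (V H) →
  DecAdj G → DecAdj H → DecAdj (G □ H)
DecAdj-□ _ _ _≟G_ _≟H_ adjG? adjH? (u₁ , v₁) (u₂ , v₂) =
  ((u₁ ≟G u₂) ×-dec adjH? v₁ v₂) ⊎-dec ((v₁ ≟H v₂) ×-dec adjG? u₁ u₂)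

productColoring : ∀ G H {a b} → (V G → Fin a) → (V H → Fin b) → V (G □ H) → Fin (a * b)
productColoring G H g h (x , y) = combine (g x) (h y)

module _ (G H : Graph) {a b : ℕ} {g : V G → Fin a} {h : V H → Fin b}
         (g-proper : Proper G a g) (h-proper : Proper H b h) where
  private
    f : V (G □ H) → Fin (a * b)
    f = productColoring G H g h

    split : ∀ {x y x′ y′} → f (x , y) ≡ f (x′ , y′) →
      g x ≡ g x′ × h y ≡ h y′
    split = combine-injective _ _ _ _

  productColoring-proper : Proper (G □ H) (a * b) f
  productColoring-proper (inj₁ (refl , vv′)) = h-proper vv′ ∘ proj₂ ∘ split
  productColoring-proper (inj₂ (refl , uu′)) = g-proper uu′ ∘ proj₁ ∘ split

  colorMissingAcrossHEdge : ∀ {u w v v′} → Adj G u w → Adj H v v′ →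
    ¬ ColorsN (G □ H) f (u , v′) (f (w , v))
  colorMissingAcrossHEdge uw vv′ (_ , inj₁ refl , c)                = h-proper vv′ (sym (proj₂ (split c)))
  colorMissingAcrossHEdge uw vv′ (_ , inj₂ (inj₁ (refl , _)) , c) = g-proper uw (proj₁ (split c))
  colorMissingAcrossHEdge uw vv′ (_ , inj₂ (inj₂ (refl , _)) , c) = h-proper vv′ (sym (proj₂ (split c)))

  colorMissingAcrossGEdge : ∀ {v w u u′} → Adj H v w → Adj G u u′ →
    ¬ ColorsN (G □ H) f (u′ , v) (f (u , w))
  colorMissingAcrossGEdge vw uu′ (_ , inj₁ refl , c)                = g-proper uu′ (sym (proj₁ (split c)))
  colorMissingAcrossGEdge vw uu′ (_ , inj₂ (inj₁ (refl , _)) , c) = g-proper uu′ (sym (proj₁ (split c)))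
  colorMissingAcrossGEdge vw uu′ (_ , inj₂ (inj₂ (refl , _)) , c) = h-proper vw (proj₂ (split c))

  -- Every edge is separated.
  productColoring-isLid : NoIsolatedVertex G → NoIsolatedVertex H →
    IsLid (G □ H) (a * b) f
  productColoring-isLid noIsolatedG noIsolatedH = productColoring-proper , separating
    where
    separating : ∀ {p q} → Adj (G □ H) p q → ¬ SameN (G □ H) p q →
      ¬ SameColors (G □ H) f p q
    separating {u , v} (inj₁ (refl , vv′)) _ same with w , uw ← noIsolatedG u =
      colorMissingAcrossHEdge uw vv′ (Equivalence.to (same _) ((w , v) , inj₂ (inj₂ (refl , uw)) , refl))
    separating {u , v} (inj₂ (refl , uu′)) _ same with w , vw ← noIsolatedH v =
      colorMissingAcrossGEdge vw uu′ (Equivalence.to (same _) ((u , w) , inj₂ (inj₁ (refl , vw)) , refl))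

theorem4 : (G H : Graph) → Finite G → Finite H → DecAdj G → DecAdj H →
    Connected G → Connected H → AtLeastTwo G → AtLeastTwo H →
    (a b : ℕ) → IsChromaticNumber G a → IsChromaticNumber H b →
    Σ ℕ λ c → IsLidChromaticNumber (G □ H) c × c ≤ a * b
theorem4 G H finG finH adjG? adjH? connG connH twoG twoH a b ((g , g-proper) , _) ((h , h-proper) , _) =
  least-below (LidColorable? (G □ H) (Finite-□ G H finG finH) adjGH?) (a * b)
    ( productColoring G H g h
    , productColoring-isLid G H g-proper h-proper
        (connected⇒noIsolatedVertex connG twoG) (connected⇒noIsolatedVertex connH twoH))
  where
  adjGH? : DecAdj (G □ H)
  adjGH? = DecAdj-□ G H (Enumeration._≟_ (proj₂ finG)) (Enumeration._≟_ (proj₂ finH)) adjG? adjH?
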